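{- Let $N, s, t$ be positive integers and let $C:[1,N]\to\{0,1\}$ be a coloring such that there is no monochromatic triple $\{x,\,x+sy,\,x+(s+t)y\}\subseteq[1,N]$ with $x$ a positive integer and $y\in\{1,2,3\}$. For $a\in[1,N-3s]$ define $V(a)=(C(a),C(a+s),C(a+2s),C(a+3s))$. Then for each $u\in\{0,1\}$ the following hold. 1) For $1\le a\le N-2s-2t$, if $C(a)=C(a+s)=u$, then $C(a+2s)=1-u$. For $s+1\le a\le N-s-2t$, if $C(a)=C(a+s)=u$, then $C(a-s)=1-u$. For $2s+1\le a\le N-2t$, if $C(a)=C(a+t)=u$, then $C(a+2t)=1-u$. For $2s+t+1\le a\le N-t$, if $C(a)=C(a+t)=u$, then $C(a-t)=1-u$. 2) For $1\le a\le N-3s-4t$, if $V(a)=(u,1-u,1-u,u)$, then $V(a+t)=(1-u,1-u,u,u)$ or $V(a+t)=(1-u,u,u,1-u)$. 3) For $1\le a\le N-3s-6t$, if $V(a)=(u,u,1-u,u)$, then $V(a+t)=(1-u,1-u,u,u)$, $V(a+2t)=(1-u,u,u,1-u)$ and $V(a+3t)=(u,u,1-u,1-u)$. 4) For $1\le a\le N-3s-5t$, if $V(a)=(u,1-u,u,u)$, then $V(a+2t)=(u,1-u,1-u,u)$ and $V(a+3t)=(1-u,u,u,1-u)$. 5) For $1\le a\le N-3s-4t$, if $V(a)=(u,1-u,1-u,u)$ and $V(a+t)=(1-u,1-u,u,u)$, then $V(a+2t)=(1-u,u,u,1-u)$; moreover, if in addition $1\le a\le N-3s-6t$, then $V(a+3t)=(u,u,1-u,1-u)$.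 For $1\le a\le N-3s-4t$, if $V(a)=(u,1-u,1-u,u)$ and $V(a+t)=(1-u,u,u,1-u)$, then $V(a+2t)=(u,1-u,1-u,u)$.
   Context: $[1,N]=\{1,2,\dots,N\}$. A set is monochromatic under $C$ if $C$ is constant on it. If $u\in\{0,1\}$ is one color, $1-u$ denotes the other color. -}

module Defs where

open import Data.Nat using (ℕ; _+_; _*_; _∸_; _≤_)
open import Data.Bool using (Bool; not)
open import Data.Product using (_×_; _,_)
open import Data.Sum using (_⊎_)
open import Relation.Binary.PropositionalEquality using (_≡_)
open import Relation.Nullary using (¬_)

-- Colours {0,1} are represented by Bool; the "other colour" 1-u is  not u.
-- A colouring C : [1,N] → {0,1} is given as a function ℕ → Bool whose values
-- outside [1,N] are never used.  "a ≤ N - k" is written  a + k ≤ N.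

NoMonoTriple : ℕ → ℕ → ℕ → (ℕ → Bool) → Set
NoMonoTriple N s t C =
  ∀ x y → 1 ≤ x → 1 ≤ y → y ≤ 3 → x + (s + t) * y ≤ N →
  ¬ (C x ≡ C (x + s * y) × C x ≡ C (x + (s + t) * y))

V : (ℕ → Bool) → ℕ → ℕ → Bool × Bool × Bool × Bool
V C s a = C a , C (a + s) , C (a + 2 * s) , C (a + 3 * s)

Part1 : ℕ → ℕ → ℕ → (ℕ → Bool) → Bool → Set
Part1 N s t C u =
  (∀ a → 1 ≤ a → a + 2 * s + 2 * t ≤ N →
     C a ≡ u → C (a + s) ≡ u → C (a + 2 * s) ≡ not u)
  × (∀ a → s + 1 ≤ a → a + s + 2 * t ≤ N →
     C a ≡ u → C (a + s) ≡ u → C (a ∸ s) ≡ not u)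
  × (∀ a → 2 * s + 1 ≤ a → a + 2 * t ≤ N →
     C a ≡ u → C (a + t) ≡ u → C (a + 2 * t) ≡ not u)
  × (∀ a → 2 * s + t + 1 ≤ a → a + t ≤ N →
     C a ≡ u → C (a + t) ≡ u → C (a ∸ t) ≡ not u)

Part2 : ℕ → ℕ → ℕ → (ℕ → Bool) → Bool → Set
Part2 N s t C u =
  ∀ a → 1 ≤ a → a + 3 * s + 4 * t ≤ N →
  V C s a ≡ (u , not u , not u , u) →
  V C s (a + t) ≡ (not u , not u , u , u) ⊎ V C s (a + t) ≡ (not u , u , u , not u)

Part3 : ℕ → ℕ → ℕ → (ℕ → Bool) → Bool → Set
Part3 N s t C u =
  ∀ a → 1 ≤ a → a + 3 * s + 6 * t ≤ N →
  V C s a ≡ (u , u , not u , u) →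
  V C s (a + t) ≡ (not u , not u , u , u)
  × V C s (a + 2 * t) ≡ (not u , u , u , not u)
  × V C s (a + 3 * t) ≡ (u , u , not u , not u)

Part4 : ℕ → ℕ → ℕ → (ℕ → Bool) → Bool → Set
Part4 N s t C u =
  ∀ a → 1 ≤ a → a + 3 * s + 5 * t ≤ N →
  V C s a ≡ (u , not u , u , u) →
  V C s (a + 2 * t) ≡ (u , not u , not u , u)
  × V C s (a + 3 * t) ≡ (not u , u , u , not u)

Part5 : ℕ → ℕ → ℕ → (ℕ → Bool) → Bool → Set
Part5 N s t C u =
  (∀ a → 1 ≤ a → a + 3 * s + 4 * t ≤ N →
     V C s a ≡ (u , not u , not u , u) →
     V C s (a + t) ≡ (not u , not u , u , u) →
     V C s (a + 2 * t) ≡ (not u , u , u , not u)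
     × (a + 3 * s + 6 * t ≤ N → V C s (a + 3 * t) ≡ (u , u , not u , not u)))
  × (∀ a → 1 ≤ a → a + 3 * s + 4 * t ≤ N →
     V C s a ≡ (u , not u , not u , u) →
     V C s (a + t) ≡ (not u , u , u , not u) →
     V C s (a + 2 * t) ≡ (u , not u , not u , u))

-- Arrange the points b + i s + j t in a grid with coordinates (i, j).  A forbidden triple
-- {x, x + s y, x + (s + t) y} is then an L-shape (i, j), (i + y, j), (i + y, j + y) with
-- 1 ≤ y ≤ 3, and V(b + j t) is the j-th row (i = 0, …, 3) of the grid.  A cell whose two
-- partners in some L-shape share a colour must take the other colour, and every claim
-- follows by propagating this rule through a grid of at most 4 × 7 cells.  Part 1 says that
-- the two legs (0,0)–(2,0) and (2,0)–(2,2) of a triangle are not monochromatic; it serves as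
-- a further propagation rule, and only two steps need a case split.

module Submission where

open import Defs
open import Data.Nat using (ℕ; _+_; _*_; _∸_; _≤_; _≤?_)
open import Data.Nat.Properties
open import Algebra.Properties.CommutativeSemigroup +-commutativeSemigroup using (xy∙z≈xz∙y)
open import Data.Nat.Tactic.RingSolver using (solve)
open import Data.List using (_∷_; [])
open import Data.Bool using (Bool; true; false; not)
open import Data.Bool.Properties using (¬-not; not-involutive)
open import Data.Product using (_×_; _,_; ∃; proj₁; proj₂)
import Data.Product as Product
open import Data.Sum using (_⊎_; inj₁; inj₂)
import Data.Sum as Sum
open import Data.Empty using (⊥)
open import Function using (case_of_)
open import Relation.Binary.PropositionalEquality
open import Relation.Nullary.Decidable using (True; toWitness; fromWitness)

variable
  a b c d a′ b′ c′ d′ u v w : Bool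

≢not⇒≡ : u ≢ not v → u ≡ v
≢not⇒≡ {v = v} u≢¬v = trans (¬-not u≢¬v) (not-involutive v)

≡⊎≡not : ∀ a b → a ≡ b ⊎ a ≡ not b
≡⊎≡not false false = inj₁ refl
≡⊎≡not false true  = inj₂ refl
≡⊎≡not true  false = inj₂ refl
≡⊎≡not true  true  = inj₁ refl

,-injective₄ : (a , b , c , d) ≡ (a′ , b′ , c′ , d′) → a ≡ a′ × b ≡ b′ × c ≡ c′ × d ≡ d′
,-injective₄ refl = refl , refl , refl , refl

,-cong₄ : a ≡ a′ → b ≡ b′ → c ≡ c′ → d ≡ d′ → (a , b , c , d) ≡ (a′ , b′ , c′ , d′)
,-cong₄ refl refl refl refl = refl

Grid : Set
Grid = ℕ → ℕ → Bool

-- The side conditions are decision witnesses, so at numerals they are discharged automatically.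
TripleFree : ℕ → ℕ → Grid → Set
TripleFree I J g =
  ∀ {c} i j y {_ : True (1 ≤? y)} {_ : True (y ≤? 3)}
              {_ : True (i + y ≤? I)} {_ : True (j + y ≤? J)} →
  g i j ≡ c → g (i + y) j ≡ c → g (i + y) (j + y) ≡ c → ⊥

subgrid : ∀ i j {I J I′ J′ g} {_ : True (i + I′ ≤? I)} {_ : True (j + J′ ≤? J)} →
          TripleFree I J g → TripleFree I′ J′ (λ k l → g (i + k) (j + l))
subgrid i j {I′ = I′} {J′} {g} {i+I′≤I} {j+J′≤J} tf {c}
        k l y {1≤y} {y≤3} {k+y≤I′} {l+y≤J′} h₀ h₁ h₂ =
  tf (i + k) (j + l) y {1≤y} {y≤3} {shifted i+I′≤I k+y≤I′} {shifted j+J′≤J l+y≤J′} h₀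
     (subst (λ m → g m (j + l) ≡ c) (sym (+-assoc i k y)) h₁)
     (subst₂ (λ m n → g m n ≡ c) (sym (+-assoc i k y)) (sym (+-assoc j l y)) h₂)
  where
  shifted : ∀ {i I I′ k} → True (i + I′ ≤? I) → True (k + y ≤? I′) → True (i + k + y ≤? I)
  shifted {i} {k = k} i+I′≤I k+y≤I′ = fromWitness (begin
    i + k + y   ≡⟨ +-assoc i k y ⟩
    i + (k + y) ≤⟨ +-monoʳ-≤ i (toWitness k+y≤I′) ⟩
    _           ≤⟨ toWitness i+I′≤I ⟩
    _           ∎)
    where open ≤-Reasoning

variable
  g : Grid

s-side-not-mono : TripleFree 2 2 g → g 0 0 ≡ u → g 1 0 ≡ u → g 2 0 ≡ u → ⊥
s-side-not-mono {g} {u} tf g00 g10 g20 = tf 1 1 1 g11 g21 g22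
  where
  g11 : g 1 1 ≡ not u
  g11 = ¬-not (tf 0 0 1 g00 g10)
  g21 : g 2 1 ≡ not u
  g21 = ¬-not (tf 1 0 1 g10 g20)
  g22 : g 2 2 ≡ not u
  g22 = ¬-not (tf 0 0 2 g00 g20)

t-side-not-mono : TripleFree 2 2 g → g 2 0 ≡ u → g 2 1 ≡ u → g 2 2 ≡ u → ⊥
t-side-not-mono {g} {u} tf g20 g21 g22 = tf 0 0 1 g00 g10 g11
  where
  g00 : g 0 0 ≡ not u
  g00 = ¬-not λ h → tf 0 0 2 h g20 g22
  g10 : g 1 0 ≡ not u
  g10 = ¬-not λ h → tf 1 0 1 h g20 g21
  g11 : g 1 1 ≡ not u
  g11 = ¬-not λ h → tf 1 1 1 h g21 g22

Row : Grid → ℕ → Bool × Bool × Bool × Bool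
Row g j = g 0 j , g 1 j , g 2 j , g 3 j

-- A stands for the colour u and B for not u.
ABBA AABA ABAA BBAA BAAB AABB : Bool → Bool × Bool × Bool × Bool
ABBA u = u , not u , not u , u
AABA u = u , u , not u , u
ABAA u = u , not u , u , u
BBAA u = not u , not u , u , u
BAAB u = not u , u , u , not u
AABB u = u , u , not u , not u

ABBA⇒BBAA⊎BAAB : TripleFree 3 4 g → Row g 0 ≡ ABBA u → Row g 1 ≡ BBAA u ⊎ Row g 1 ≡ BAAB u
ABBA⇒BBAA⊎BAAB {g} {u} tf r₀ with ,-injective₄ r₀
... | g00 , g10 , g20 , g30 = case ≡⊎≡not (g 1 1) u of λ where
    (inj₁ g11) → inj₂ (,-cong₄ g01 g11 g21 (g31-if-u g11))
    (inj₂ g11) → inj₁ (,-cong₄ g01 g11 g21 (≢not⇒≡ λ h → tf 1 1 2 g11 h g33))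
  where
  g21 : g 2 1 ≡ u
  g21 = ≢not⇒≡ (tf 1 0 1 g10 g20)
  g33 : g 3 3 ≡ not u
  g33 = ¬-not (tf 0 0 3 g00 g30)
  g31-if-u : g 1 1 ≡ u → g 3 1 ≡ not u
  g31-if-u g11 = ¬-not λ h → tf 2 1 1 g21 h g32
    where
    g22 : g 2 2 ≡ not u
    g22 = ¬-not (tf 1 1 1 g11 g21)
    g32 : g 3 2 ≡ u
    g32 = ≢not⇒≡ λ h → tf 2 2 1 g22 h g33
  g01≢u : g 0 1 ≢ u
  g01≢u g01 = tf 1 2 1 g12 g22 g23
    where
    g23 : g 2 3 ≡ not u
    g23 = ¬-not (tf 0 1 2 g01 g21)
    g34 : g 3 4 ≡ u
    g34 = ≢not⇒≡ (tf 2 3 1 g23 g33)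
    g31 : g 3 1 ≡ not u
    g31 = ¬-not λ h → tf 0 1 3 g01 h g34
    g11 : g 1 1 ≡ u
    g11 = ≢not⇒≡ λ h → tf 1 1 2 h g31 g33
    g12 : g 1 2 ≡ not u
    g12 = ¬-not (tf 0 1 1 g01 g11)
    g22 : g 2 2 ≡ not u
    g22 = ¬-not (tf 1 1 1 g11 g21)
  g01 : g 0 1 ≡ not u
  g01 = ¬-not g01≢u

AABA⇒BBAA : TripleFree 3 4 g → Row g 0 ≡ AABA u → Row g 1 ≡ BBAA u
AABA⇒BBAA {g} {u} tf r₀ with ,-injective₄ r₀
... | g00 , g10 , _ , g30 = ,-cong₄ g01 g11 g21 g31
  where
  g11 : g 1 1 ≡ not u
  g11 = ¬-not (tf 0 0 1 g00 g10)
  g33 : g 3 3 ≡ not u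
  g33 = ¬-not (tf 0 0 3 g00 g30)
  g31 : g 3 1 ≡ u
  g31 = ≢not⇒≡ λ h → tf 1 1 2 g11 h g33
  g32 : g 3 2 ≡ not u
  g32 = ¬-not (tf 1 0 2 g10 g30)
  g34 : g 3 4 ≡ u
  g34 = ≢not⇒≡ (t-side-not-mono (subgrid 1 2 tf) g32 g33)
  g01 : g 0 1 ≡ not u
  g01 = ¬-not λ h → tf 0 1 3 h g31 g34
  g12 : g 1 2 ≡ u
  g12 = ≢not⇒≡ (tf 0 1 1 g01 g11)
  g22 : g 2 2 ≡ u
  g22 = ≢not⇒≡ λ h → tf 2 2 1 h g32 g33
  g23 : g 2 3 ≡ not u
  g23 = ¬-not (tf 1 2 1 g12 g22)
  g21 : g 2 1 ≡ u
  g21 = ≢not⇒≡ λ h → tf 0 1 2 g01 h g23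

BBAA⇒BAAB : TripleFree 3 4 g → Row g 0 ≡ (u , v , w , u) → Row g 1 ≡ BBAA u → Row g 2 ≡ BAAB u
BBAA⇒BAAB {g} {u} tf r₀ r₁ with ,-injective₄ r₀ | ,-injective₄ r₁
... | g00 , _ , _ , g30 | g01 , g11 , g21 , g31 = ,-cong₄ g02 g12 g22 g32
  where
  g12 : g 1 2 ≡ u
  g12 = ≢not⇒≡ (tf 0 1 1 g01 g11)
  g32 : g 3 2 ≡ not u
  g32 = ¬-not (tf 2 1 1 g21 g31)
  g33 : g 3 3 ≡ not u
  g33 = ¬-not (tf 0 0 3 g00 g30)
  g22 : g 2 2 ≡ u
  g22 = ≢not⇒≡ λ h → tf 2 2 1 h g32 g33
  g02 : g 0 2 ≡ not u
  g02 = ¬-not λ h → s-side-not-mono (subgrid 0 2 tf) h g12 g22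

BBAA⇒BAAB⇒AABB : TripleFree 3 6 g → Row g 0 ≡ (u , v , w , u) → Row g 1 ≡ BBAA u → Row g 3 ≡ AABB u
BBAA⇒BAAB⇒AABB {g} {u} tf r₀ r₁
  with ,-injective₄ r₀ | ,-injective₄ (BBAA⇒BAAB (subgrid 0 0 tf) r₀ r₁)
... | g00 , _ , _ , g30 | g02 , g12 , g22 , g32 = ,-cong₄ g03 g13 g23 g33
  where
  g33 : g 3 3 ≡ not u
  g33 = ¬-not (tf 0 0 3 g00 g30)
  g23 : g 2 3 ≡ not u
  g23 = ¬-not (tf 1 2 1 g12 g22)
  g34 : g 3 4 ≡ u
  g34 = ≢not⇒≡ (tf 2 3 1 g23 g33)
  g35 : g 3 5 ≡ u
  g35 = ≢not⇒≡ (tf 0 2 3 g02 g32)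
  g24 : g 2 4 ≡ not u
  g24 = ¬-not λ h → tf 2 4 1 h g34 g35
  g25 : g 2 5 ≡ u
  g25 = ≢not⇒≡ (t-side-not-mono (subgrid 0 3 tf) g23 g24)
  g36 : g 3 6 ≡ not u
  g36 = ¬-not (tf 2 5 1 g25 g35)
  g03 : g 0 3 ≡ u
  g03 = ≢not⇒≡ λ h → tf 0 3 3 h g33 g36
  g13 : g 1 3 ≡ u
  g13 = ≢not⇒≡ λ h → tf 1 3 1 h g23 g24

BAAB⇒ABBA : TripleFree 3 4 g → Row g 0 ≡ (u , v , w , u) → Row g 1 ≡ BAAB u → Row g 2 ≡ ABBA u
BAAB⇒ABBA {g} {u} tf r₀ r₁ with ,-injective₄ r₀ | ,-injective₄ r₁
... | g00 , _ , _ , g30 | g01 , g11 , g21 , g31 = ,-cong₄ g02 g12 g22 g32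
  where
  g22 : g 2 2 ≡ not u
  g22 = ¬-not (tf 1 1 1 g11 g21)
  g33 : g 3 3 ≡ not u
  g33 = ¬-not (tf 0 0 3 g00 g30)
  g32 : g 3 2 ≡ u
  g32 = ≢not⇒≡ λ h → tf 2 2 1 g22 h g33
  g34 : g 3 4 ≡ u
  g34 = ≢not⇒≡ (tf 0 1 3 g01 g31)
  g12 : g 1 2 ≡ not u
  g12 = ¬-not λ h → tf 1 2 2 h g32 g34
  g02 : g 0 2 ≡ u
  g02 = ≢not⇒≡ λ h → s-side-not-mono (subgrid 0 2 tf) h g12 g22

ABAA⇒·⇒ABBA⇒BAAB : TripleFree 3 5 g → Row g 0 ≡ ABAA u → Row g 2 ≡ ABBA u × Row g 3 ≡ BAAB u
ABAA⇒·⇒ABBA⇒BAAB {g} {u} tf r₀ with ,-injective₄ r₀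
... | g00 , _ , g20 , g30 = ,-cong₄ g02 g12 g22 g32 , ,-cong₄ g03 g13 g23 g33
  where
  g31 : g 3 1 ≡ not u
  g31 = ¬-not (tf 2 0 1 g20 g30)
  g33 : g 3 3 ≡ not u
  g33 = ¬-not (tf 0 0 3 g00 g30)
  g11 : g 1 1 ≡ u
  g11 = ≢not⇒≡ λ h → tf 1 1 2 h g31 g33
  g22 : g 2 2 ≡ not u
  g22 = ¬-not (tf 0 0 2 g00 g20)
  g32 : g 3 2 ≡ u
  g32 = ≢not⇒≡ λ h → tf 2 2 1 g22 h g33
  g12 : g 1 2 ≡ not u
  g12 = case ≡⊎≡not (g 0 1) u of λ where
    (inj₁ g01) → ¬-not (tf 0 1 1 g01 g11)
    (inj₂ g01) → ¬-not λ h → tf 1 2 2 h g32 (≢not⇒≡ (tf 0 1 3 g01 g31))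
  g02 : g 0 2 ≡ u
  g02 = ≢not⇒≡ λ h → s-side-not-mono (subgrid 0 2 tf) h g12 g22
  g35 : g 3 5 ≡ not u
  g35 = ¬-not (tf 0 2 3 g02 g32)
  g13 : g 1 3 ≡ u
  g13 = ≢not⇒≡ λ h → tf 1 3 2 h g33 g35
  g23 : g 2 3 ≡ u
  g23 = ≢not⇒≡ (tf 1 2 1 g12 g22)
  g03 : g 0 3 ≡ not u
  g03 = ¬-not λ h → s-side-not-mono (subgrid 0 3 tf) h g13 g23

k+1≤n⇒∃[m]n≡m+k : ∀ {k n} → k + 1 ≤ n → ∃ λ m → 1 ≤ m × n ≡ m + k
k+1≤n⇒∃[m]n≡m+k {k} {n} k+1≤n =
  n ∸ k ,
  subst (_≤ n ∸ k) (m+n∸m≡n k 1) (∸-monoˡ-≤ k k+1≤n) ,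
  sym (m∸n+n≡m (≤-trans (m≤m+n k 1) k+1≤n))

module _ {N s t : ℕ} {C : ℕ → Bool} (noMono : NoMonoTriple N s t C) where

  grid : ℕ → Grid
  grid b i j = C (b + i * s + j * t)

  tripleFree : ∀ {b I J} → 1 ≤ b → b + I * s + J * t ≤ N → TripleFree I J (grid b)
  tripleFree {b} {I} {J} 1≤b bound i j y {1≤y} {y≤3} {i+y≤I} {j+y≤J} h₀ h₁ h₂ =
    noMono (b + i * s + j * t) y positive (toWitness 1≤y) (toWitness y≤3) in-range
      (trans h₀ (sym (trans (cong C vertical) h₁)) ,
       trans h₀ (sym (trans (cong C diagonal) h₂)))
    where
    vertical : b + i * s + j * t + s * y ≡ b + (i + y) * s + j * t
    vertical = solve (b ∷ i ∷ j ∷ y ∷ s ∷ t ∷ [])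
    diagonal : b + i * s + j * t + (s + t) * y ≡ b + (i + y) * s + (j + y) * t
    diagonal = solve (b ∷ i ∷ j ∷ y ∷ s ∷ t ∷ [])
    positive : 1 ≤ b + i * s + j * t
    positive = ≤-trans 1≤b (≤-trans (m≤m+n b (i * s)) (m≤m+n (b + i * s) (j * t)))
    in-range : b + i * s + j * t + (s + t) * y ≤ N
    in-range = begin
      b + i * s + j * t + (s + t) * y ≡⟨ diagonal ⟩
      b + (i + y) * s + (j + y) * t   ≤⟨ +-mono-≤ (+-monoʳ-≤ b (*-monoˡ-≤ s (toWitness i+y≤I)))
                                                   (*-monoˡ-≤ t (toWitness j+y≤J)) ⟩
      b + I * s + J * t               ≤⟨ bound ⟩
      N                               ∎
      where open ≤-Reasoning

  V≡Row : ∀ {a} b k → a ≡ b + k * t → V C s a ≡ Row (grid b) k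
  V≡Row b k refl = ,-cong₄
    (cong C (cong (_+ k * t) (sym (+-identityʳ b))))
    (cong C (trans (cong (b + k * t +_) (sym (*-identityˡ s))) (xy∙z≈xz∙y b (k * t) (1 * s))))
    (cong C (xy∙z≈xz∙y b (k * t) (2 * s)))
    (cong C (xy∙z≈xz∙y b (k * t) (3 * s)))

  module Rows (a : ℕ) where
    V₀ : V C s a ≡ Row (grid a) 0
    V₀ = V≡Row a 0 (sym (+-identityʳ a))
    V₁ : V C s (a + t) ≡ Row (grid a) 1
    V₁ = V≡Row a 1 (cong (a +_) (sym (*-identityˡ t)))
    V₂ : V C s (a + 2 * t) ≡ Row (grid a) 2
    V₂ = V≡Row a 2 refl
    V₃ : V C s (a + 3 * t) ≡ Row (grid a) 3
    V₃ = V≡Row a 3 refl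

  s-progression-not-mono : ∀ {x} → 1 ≤ x → x + 2 * s + 2 * t ≤ N →
                           C x ≡ u → C (x + s) ≡ u → C (x + 2 * s) ≡ u → ⊥
  s-progression-not-mono {x = x} 1≤x bound h₀ h₁ h₂ with ,-injective₄ (Rows.V₀ x)
  ... | e₀ , e₁ , e₂ , _ =
    s-side-not-mono (tripleFree 1≤x bound)
      (trans (sym e₀) h₀) (trans (sym e₁) h₁) (trans (sym e₂) h₂)

  t-progression-not-mono : ∀ {x} → 1 ≤ x → x + 2 * s + 2 * t ≤ N →
                           C (x + 2 * s) ≡ u → C (x + 2 * s + t) ≡ u → C (x + 2 * s + 2 * t) ≡ u → ⊥
  t-progression-not-mono {x = x} 1≤x bound h₀ h₁ h₂ = t-side-not-mono (tripleFree 1≤x bound)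
    (trans (cong C (+-identityʳ (x + 2 * s))) h₀)
    (trans (cong C (cong (x + 2 * s +_) (*-identityˡ t))) h₁)
    h₂

  part1 : Part1 N s t C u
  proj₁ part1 a 1≤a bound h₀ h₁ = ¬-not (s-progression-not-mono 1≤a bound h₀ h₁)
  proj₁ (proj₂ part1) a s+1≤a bound h₀ h₁ with k+1≤n⇒∃[m]n≡m+k s+1≤a
  ... | x , 1≤x , refl = trans (cong C (m+n∸n≡m x s)) (¬-not λ h →
    s-progression-not-mono 1≤x (subst (λ n → n + 2 * t ≤ N) x+s+s≡x+2s bound) h h₀
      (trans (cong C (sym x+s+s≡x+2s)) h₁))
    where
    x+s+s≡x+2s : x + s + s ≡ x + 2 * s
    x+s+s≡x+2s = solve (x ∷ s ∷ [])
  proj₁ (proj₂ (proj₂ part1)) a 2s+1≤a bound h₀ h₁ with k+1≤n⇒∃[m]n≡m+k 2s+1≤a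
  ... | x , 1≤x , refl = ¬-not (t-progression-not-mono 1≤x bound h₀ h₁)
  proj₂ (proj₂ (proj₂ part1)) a 2s+t+1≤a bound h₀ h₁ with k+1≤n⇒∃[m]n≡m+k 2s+t+1≤a
  ... | x , 1≤x , refl = trans (cong C (trans (cong (_∸ t) shift₁) (m+n∸n≡m (x + 2 * s) t))) (¬-not λ h →
    t-progression-not-mono 1≤x (subst (_≤ N) shift₂ bound) h
      (trans (cong C (sym shift₁)) h₀) (trans (cong C (sym shift₂)) h₁))
    where
    shift₁ : x + (2 * s + t) ≡ x + 2 * s + t
    shift₁ = solve (x ∷ s ∷ t ∷ [])
    shift₂ : x + (2 * s + t) + t ≡ x + 2 * s + 2 * t
    shift₂ = solve (x ∷ s ∷ t ∷ [])

  part2 : Part2 N s t C u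
  part2 a 1≤a bound r₀ =
    Sum.map (trans V₁) (trans V₁) (ABBA⇒BBAA⊎BAAB (tripleFree 1≤a bound) (trans (sym V₀) r₀))
    where open Rows a

  part3 : Part3 N s t C u
  part3 {u = u} a 1≤a bound r₀ =
    trans V₁ r₁ , trans V₂ (BBAA⇒BAAB (subgrid 0 0 tf) r₀′ r₁) , trans V₃ (BBAA⇒BAAB⇒AABB tf r₀′ r₁)
    where
    open Rows a
    tf : TripleFree 3 6 (grid a)
    tf = tripleFree 1≤a bound
    r₀′ : Row (grid a) 0 ≡ AABA u
    r₀′ = trans (sym V₀) r₀
    r₁ : Row (grid a) 1 ≡ BBAA u
    r₁ = AABA⇒BBAA (subgrid 0 0 tf) r₀′

  part4 : Part4 N s t C u
  part4 a 1≤a bound r₀ =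
    Product.map (trans V₂) (trans V₃) (ABAA⇒·⇒ABBA⇒BAAB (tripleFree 1≤a bound) (trans (sym V₀) r₀))
    where open Rows a

  part5 : Part5 N s t C u
  proj₁ (part5 {u = u}) a 1≤a bound r₀ r₁ =
    trans V₂ (BBAA⇒BAAB (tripleFree 1≤a bound) r₀′ r₁′) ,
    λ bound′ → trans V₃ (BBAA⇒BAAB⇒AABB (tripleFree 1≤a bound′) r₀′ r₁′)
    where
    open Rows a
    r₀′ : Row (grid a) 0 ≡ ABBA u
    r₀′ = trans (sym V₀) r₀
    r₁′ : Row (grid a) 1 ≡ BBAA u
    r₁′ = trans (sym V₁) r₁
  proj₂ part5 a 1≤a bound r₀ r₁ =
    trans V₂ (BAAB⇒ABBA (tripleFree 1≤a bound) (trans (sym V₀) r₀) (trans (sym V₁) r₁))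
    where open Rows a

mainTheorem1 : (N s t : ℕ) → 1 ≤ N → 1 ≤ s → 1 ≤ t →
    (C : ℕ → Bool) → NoMonoTriple N s t C →
    (u : Bool) →
    Part1 N s t C u × Part2 N s t C u × Part3 N s t C u ×
    Part4 N s t C u × Part5 N s t C u
mainTheorem1 N s t _ _ _ C noMono u =
  part1 noMono , part2 noMono , part3 noMono , part4 noMono , part5 noMono
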